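{- Let \((X,d_1)\) be an arbitrary semimetric space, and let \(A\), \(B\) be disjoint proximinal subsets of \((X,d_1)\) such that the proximinal graph \(G_{X,d_1}(A,B)\) is nonempty. Then there is a metric \(d_2\colon X\times X\to[0,\infty)\) such that \(A\), \(B\) are proximinal in \((X,d_2)\), \(G_{X,d_1}(A,B)=G_{X,d_2}(A,B)\), and the distance set satisfies \(|D(X,d_2)|\le 3\), where \(D(X,d_2)=\{d_2(x,y)\colon x,y\in X\}\).
   Context: A semimetric on a nonempty set \(X\) is a function \(d\colon X\times X\to[0,\infty)\) with \(d(x,y)=d(y,x)\) and \(d(x,y)=0\iff x=y\). A set \(A\subseteq X\) is proximinal in \((X,d)\) if for every \(x\in X\) there is \(a_0\in A\) with \(d(x,a_0)=\inf\{d(x,a)\colon a\in A\}\). For nonempty \(A,B\subseteq X\), \(\operatorname{dist}(A,B)=\inf\{d(a,b)\colon a\in A,b\in B\}\). For disjoint proximinal \(A,B\subseteq X\), \(G_{X,d}(A,B)\) denotes the bipartite graph with parts \(A\), \(B\) (vertex set \(A\cup B\)) in which \(a\in A\) and \(b\in B\) are adjacent iff \(d(a,b)=\operatorname{dist}(A,B)\). A graph is nonempty if it has at least one edge. -}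

module Defs where

open import Level using (0ℓ)
open import Data.Product using (Σ; ∃; _×_; _,_)
open import Data.Sum using (_⊎_)
open import Data.Empty using (⊥)
open import Relation.Nullary using (¬_; Dec)
open import Relation.Binary.PropositionalEquality using (_≡_)
open import Relation.Binary.Structures using (IsTotalOrder)
open import Algebra.Structures using (IsCommutativeRing)

-- An abstract model of the real numbers: a complete ordered field.
-- (Any two such are isomorphic, so quantifying over all of them is the
-- same as speaking about ℝ.)
record RealField : Set₁ where
  infixl 6 _+_
  infixl 7 _*_
  infix 4 _≤_
  field
    ℝ : Set
    _+_ _*_ : ℝ → ℝ → ℝ
    -_ : ℝ → ℝ
    0r 1r : ℝ
    _≤_ : ℝ → ℝ → Set
    isCommutativeRing : IsCommutativeRing _≡_ _+_ _*_ -_ 0r 1r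
    0≢1 : ¬ (0r ≡ 1r)
    inverse : ∀ x → ¬ (x ≡ 0r) → ∃ λ y → x * y ≡ 1r
    isTotalOrder : IsTotalOrder _≡_ _≤_
    +-mono-≤ : ∀ {x y} z → x ≤ y → x + z ≤ y + z
    *-nonneg : ∀ {x y} → 0r ≤ x → 0r ≤ y → 0r ≤ x * y
    complete : (S : ℝ → Set) → (∃ λ x → S x) →
               (∃ λ u → ∀ x → S x → x ≤ u) →
               ∃ λ s → (∀ x → S x → x ≤ s) ×
                       (∀ u → (∀ x → S x → x ≤ u) → s ≤ u)

LEM : Set₁
LEM = (P : Set) → Dec P

module WithReals (R : RealField) where
  open RealField R

  record IsSemimetric {X : Set} (d : X → X → ℝ) : Set where
    field
      nonneg : ∀ x y → 0r ≤ d x y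
      sym    : ∀ x y → d x y ≡ d y x
      zero⇔  : ∀ x y → (d x y ≡ 0r → x ≡ y) × (x ≡ y → d x y ≡ 0r)

  record IsMetric {X : Set} (d : X → X → ℝ) : Set where
    field
      isSemimetric : IsSemimetric d
      triangle     : ∀ x y z → d x z ≤ d x y + d y z

  Disjoint : {X : Set} → (A B : X → Set) → Set
  Disjoint {X} A B = ∀ x → A x → B x → ⊥

  Proximinal : {X : Set} → (X → X → ℝ) → (X → Set) → Set
  Proximinal {X} d A = ∀ x → ∃ λ a₀ → A a₀ × (∀ a → A a → d x a₀ ≤ d x a)

  -- Edge of G_{X,d}(A,B): a ∈ A, b ∈ B and d(a,b) = dist(A,B),
  -- i.e. d(a,b) is the minimum of d over A × B.
  Edge : {X : Set} → (X → X → ℝ) → (A B : X → Set) → X → X → Set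
  Edge {X} d A B a b =
    A a × B b × (∀ a′ b′ → A a′ → B b′ → d a b ≤ d a′ b′)

  NonemptyGraph : {X : Set} → (X → X → ℝ) → (A B : X → Set) → Set
  NonemptyGraph d A B = ∃ λ a → ∃ λ b → Edge d A B a b

  -- Both graphs have vertex set A ∪ B; they coincide iff the edge sets agree.
  SameGraph : {X : Set} → (d₁ d₂ : X → X → ℝ) → (A B : X → Set) → Set
  SameGraph {X} d₁ d₂ A B =
    ∀ a b → (Edge d₁ A B a b → Edge d₂ A B a b) × (Edge d₂ A B a b → Edge d₁ A B a b)

  DistanceSetAtMost3 : {X : Set} → (X → X → ℝ) → Set
  DistanceSetAtMost3 {X} d =
    ∃ λ r₁ → ∃ λ r₂ → ∃ λ r₃ →
      ∀ x y → d x y ≡ r₁ ⊎ (d x y ≡ r₂ ⊎ d x y ≡ r₃)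

{-# OPTIONS --safe #-}

-- Only the graph G_{X,d₁}(A,B) has to survive, so keep nothing of d₁ but its edges:
-- d₂ x y is 0 if x = y, 1 if x y is an edge (in either orientation) and 2 otherwise.
-- A semimetric with values in {0,1,2} is a metric, because two nonzero values already
-- sum to at least 2, and every nonempty set is proximinal for it, because a
-- {0,1,2}-valued function attains its minimum. Since A and B are disjoint, d₂ is at
-- least 1 on A × B and equals 1 exactly on the old edges; as some old edge exists,
-- dist(A,B) = 1 for d₂, so the edges of d₂ are precisely those of d₁.
module Submission where

open import Defs
open import Data.Product using (∃; _×_; _,_; proj₁; proj₂)
open import Data.Sum using (_⊎_; inj₁; inj₂)
open import Data.Empty using (⊥-elim)
open import Relation.Nullary using (¬_; Dec; yes; no)
open import Relation.Binary.PropositionalEquality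
  using (_≡_; refl; sym; trans; cong; subst; subst₂)
open import Relation.Binary.Structures using (IsTotalOrder)
open import Algebra.Structures using (IsCommutativeRing)
open import Algebra.Bundles using (Ring)
import Algebra.Properties.Ring as RingProperties

data Val : Set where
  Z O T : Val

data _≼_ : Val → Val → Set where
  Z≼  : ∀ {v} → Z ≼ v
  O≼O : O ≼ O
  O≼T : O ≼ T
  T≼T : T ≼ T

≡Z⊎O≼ : ∀ v → v ≡ Z ⊎ O ≼ v
≡Z⊎O≼ Z = inj₁ refl
≡Z⊎O≼ O = inj₂ O≼O
≡Z⊎O≼ T = inj₂ O≼T

≢Z⇒O≼ : ∀ {v} → ¬ (v ≡ Z) → O ≼ v
≢Z⇒O≼ {v} v≢Z with ≡Z⊎O≼ v
... | inj₁ v≡Z = ⊥-elim (v≢Z v≡Z)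
... | inj₂ O≼v = O≼v

≼T : ∀ v → v ≼ T
≼T Z = Z≼
≼T O = O≼T
≼T T = T≼T

≼Z⇒≡Z : ∀ {v} → v ≼ Z → v ≡ Z
≼Z⇒≡Z Z≼ = refl

minimum-attained : LEM → {X : Set} (f : X → Val) (P : X → Set) →
                   ∃ P → ∃ λ a → P a × (∀ a′ → P a′ → f a ≼ f a′)
minimum-attained lem f P (p , Pp)
  with lem (∃ λ a → P a × f a ≡ Z) | lem (∃ λ a → P a × f a ≡ O)
... | yes (a , Pa , fa≡Z) | _ = a , Pa , λ a′ _ → subst (_≼ f a′) (sym fa≡Z) Z≼
... | no ¬Z | yes (a , Pa , fa≡O) = a , Pa , λ a′ Pa′ →
        subst (_≼ f a′) (sym fa≡O) (≢Z⇒O≼ (λ fa′≡Z → ¬Z (a′ , Pa′ , fa′≡Z)))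
... | no ¬Z | no ¬O = p , Pp , λ a′ Pa′ → subst₂ _≼_ (sym (≡T Pp)) (sym (≡T Pa′)) T≼T
  where
    ≡T : ∀ {a} → P a → f a ≡ T
    ≡T {a} Pa with f a in fa≡
    ... | Z = ⊥-elim (¬Z (a , Pa , fa≡))
    ... | O = ⊥-elim (¬O (a , Pa , fa≡))
    ... | T = refl

module RealFieldProperties (R : RealField) where
  open RealField R
  open IsCommutativeRing isCommutativeRing
    using (isRing; +-comm; +-identityˡ; +-identityʳ; +-assoc; -‿inverseʳ)
  open IsTotalOrder isTotalOrder using (antisym; total) renaming (trans to ≤-trans)

  ring : Ring _ _
  ring = record { isRing = isRing }

  open RingProperties ring using (-1*x≈-x; -‿involutive)

  2r : ℝ
  2r = 1r + 1r

  -- From 1 ≤ 0 we would get 0 ≤ -1, hence 0 ≤ (-1)(-1) = 1.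
  1≰0 : ¬ (1r ≤ 0r)
  1≰0 1≤0 = 0≢1 (antisym 0≤1 1≤0)
    where
      0≤-1 : 0r ≤ - 1r
      0≤-1 = subst₂ _≤_ (-‿inverseʳ 1r) (+-identityˡ (- 1r)) (+-mono-≤ (- 1r) 1≤0)
      0≤1 : 0r ≤ 1r
      0≤1 = subst (0r ≤_) (trans (-1*x≈-x (- 1r)) (-‿involutive 1r)) (*-nonneg 0≤-1 0≤-1)

  0≤1 : 0r ≤ 1r
  0≤1 with total 0r 1r
  ... | inj₁ 0≤1 = 0≤1
  ... | inj₂ 1≤0 = ⊥-elim (1≰0 1≤0)

  x≤y+x : ∀ {y} x → 0r ≤ y → x ≤ y + x
  x≤y+x {y} x 0≤y = subst (_≤ y + x) (+-identityˡ x) (+-mono-≤ x 0≤y)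

  x≤x+y : ∀ {y} x → 0r ≤ y → x ≤ x + y
  x≤x+y {y} x 0≤y = subst (x ≤_) (+-comm y x) (x≤y+x x 0≤y)

  +-mono-≤₂ : ∀ {x y u v} → x ≤ y → u ≤ v → x + u ≤ y + v
  +-mono-≤₂ {_} {y} {u} {v} x≤y u≤v =
    ≤-trans (+-mono-≤ u x≤y) (subst₂ _≤_ (+-comm u y) (+-comm v y) (+-mono-≤ y u≤v))

  1≤2 : 1r ≤ 2r
  1≤2 = x≤y+x 1r 0≤1

  0≤2 : 0r ≤ 2r
  0≤2 = ≤-trans 0≤1 1≤2

  2≰1 : ¬ (2r ≤ 1r)
  2≰1 2≤1 = 1≰0 (subst₂ _≤_ 2-1≡1 (-‿inverseʳ 1r) (+-mono-≤ (- 1r) 2≤1))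
    where
      2-1≡1 : 2r + - 1r ≡ 1r
      2-1≡1 = trans (+-assoc 1r 1r (- 1r)) (trans (cong (1r +_) (-‿inverseʳ 1r)) (+-identityʳ 1r))

  2≰0 : ¬ (2r ≤ 0r)
  2≰0 2≤0 = 2≰1 (≤-trans 2≤0 0≤1)

module ThreeValued (R : RealField) where
  open RealField R
  open WithReals R
  open RealFieldProperties R
  open IsTotalOrder isTotalOrder using () renaming (trans to ≤-trans; refl to ≤-refl)

  val : Val → ℝ
  val Z = 0r
  val O = 1r
  val T = 2r

  val-mono : ∀ {v w} → v ≼ w → val v ≤ val w
  val-mono {w = Z} Z≼ = ≤-refl
  val-mono {w = O} Z≼ = 0≤1
  val-mono {w = T} Z≼ = 0≤2
  val-mono O≼O = ≤-refl
  val-mono O≼T = 1≤2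
  val-mono T≼T = ≤-refl

  val-cancel-≤ : ∀ {v w} → val v ≤ val w → v ≼ w
  val-cancel-≤ {Z} _ = Z≼
  val-cancel-≤ {O} {Z} 1≤0 = ⊥-elim (1≰0 1≤0)
  val-cancel-≤ {O} {O} _ = O≼O
  val-cancel-≤ {O} {T} _ = O≼T
  val-cancel-≤ {T} {Z} 2≤0 = ⊥-elim (2≰0 2≤0)
  val-cancel-≤ {T} {O} 2≤1 = ⊥-elim (2≰1 2≤1)
  val-cancel-≤ {T} {T} _ = T≼T

  val≡0⇒≡Z : ∀ {v} → val v ≡ 0r → v ≡ Z
  val≡0⇒≡Z val≡0 = ≼Z⇒≡Z (val-cancel-≤ (subst (_≤ 0r) (sym val≡0) ≤-refl))

  module _ {X : Set} (t : X → X → Val) where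

    valued : X → X → ℝ
    valued x y = val (t x y)

    isMetric : (∀ x y → t x y ≡ t y x) → (∀ x y → t x y ≡ Z → x ≡ y) →
               (∀ x → t x x ≡ Z) → IsMetric valued
    isMetric t-sym t≡Z⇒≡ t-refl = record
      { isSemimetric = record
        { nonneg = λ x y → val-mono {w = t x y} Z≼
        ; sym    = λ x y → cong val (t-sym x y)
        ; zero⇔  = λ x y → (λ dxy≡0 → t≡Z⇒≡ x y (val≡0⇒≡Z dxy≡0))
                         , λ { refl → cong val (t-refl x) }
        }
      ; triangle = triangle
      }
      where
        triangle : ∀ x y z → valued x z ≤ valued x y + valued y z
        triangle x y z with ≡Z⊎O≼ (t x y) | ≡Z⊎O≼ (t y z)
        ... | inj₁ txy≡Z | _ with refl ← t≡Z⇒≡ x y txy≡Z =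
          x≤y+x (valued x z) (val-mono {w = t x x} Z≼)
        ... | inj₂ _ | inj₁ tyz≡Z with refl ← t≡Z⇒≡ y z tyz≡Z =
          x≤x+y (valued x y) (val-mono {w = t y y} Z≼)
        ... | inj₂ O≼txy | inj₂ O≼tyz =
          ≤-trans (val-mono (≼T (t x z))) (+-mono-≤₂ (val-mono O≼txy) (val-mono O≼tyz))

    proximinal : LEM → (P : X → Set) → ∃ P → Proximinal valued P
    proximinal lem P nonempty x with minimum-attained lem (t x) P nonempty
    ... | a , Pa , minimal = a , Pa , λ a′ Pa′ → val-mono (minimal a′ Pa′)

    distanceSetAtMost3 : DistanceSetAtMost3 valued
    distanceSetAtMost3 = 0r , 1r , 2r , λ x y → cases (t x y)
      where
        cases : ∀ v → val v ≡ 0r ⊎ (val v ≡ 1r ⊎ val v ≡ 2r)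
        cases Z = inj₁ refl
        cases O = inj₂ (inj₁ refl)
        cases T = inj₂ (inj₂ refl)

module TruncatedGraph (lem : LEM) {X : Set} (E : X → X → Set) where

  tag : X → X → Val
  tag x y with lem (x ≡ y) | lem (E x y)
  ... | yes _ | _     = Z
  ... | no _  | yes _ = O
  ... | no _  | no _  = T

  tag-refl : ∀ x → tag x x ≡ Z
  tag-refl x with lem (x ≡ x)
  ... | yes _ = refl
  ... | no x≢x = ⊥-elim (x≢x refl)

  tag-adjacent : ∀ {x y} → ¬ (x ≡ y) → E x y → tag x y ≡ O
  tag-adjacent {x} {y} x≢y e with lem (x ≡ y) | lem (E x y)
  ... | yes x≡y | _     = ⊥-elim (x≢y x≡y)
  ... | no _    | yes _ = refl
  ... | no _    | no ¬e = ⊥-elim (¬e e)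

  tag-nonadjacent : ∀ {x y} → ¬ (x ≡ y) → ¬ E x y → tag x y ≡ T
  tag-nonadjacent {x} {y} x≢y ¬e with lem (x ≡ y) | lem (E x y)
  ... | yes x≡y | _     = ⊥-elim (x≢y x≡y)
  ... | no _    | yes e = ⊥-elim (¬e e)
  ... | no _    | no _  = refl

  tag≡Z⇒≡ : ∀ x y → tag x y ≡ Z → x ≡ y
  tag≡Z⇒≡ x y with lem (x ≡ y) | lem (E x y)
  ... | yes x≡y | _     = λ _ → x≡y
  ... | no _    | yes _ = λ ()
  ... | no _    | no _  = λ ()

  tag≼O⇒adjacent : ∀ {x y} → ¬ (x ≡ y) → tag x y ≼ O → E x y
  tag≼O⇒adjacent {x} {y} x≢y txy≼O = byCases (lem (E x y))
    where
      byCases : Dec (E x y) → E x y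
      byCases (yes e) = e
      byCases (no ¬e) with () ← subst (_≼ O) (tag-nonadjacent x≢y ¬e) txy≼O

  tag-sym : (∀ {x y} → E x y → E y x) → ∀ x y → tag x y ≡ tag y x
  tag-sym E-sym x y = byCases (lem (x ≡ y)) (lem (E x y))
    where
      byCases : Dec (x ≡ y) → Dec (E x y) → tag x y ≡ tag y x
      byCases (yes refl) _ = refl
      byCases (no x≢y) (yes e) =
        trans (tag-adjacent x≢y e) (sym (tag-adjacent (λ y≡x → x≢y (sym y≡x)) (E-sym e)))
      byCases (no x≢y) (no ¬e) =
        trans (tag-nonadjacent x≢y ¬e)
              (sym (tag-nonadjacent (λ y≡x → x≢y (sym y≡x)) (λ e → ¬e (E-sym e))))

module EdgesOfTruncatedGraph (R : RealField) (lem : LEM) {X : Set} (d₁ : X → X → RealField.ℝ R)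
                             (A B : X → Set) (disjoint : WithReals.Disjoint R A B) where
  open RealField R
  open WithReals R
  open ThreeValued R

  Adjacent : X → X → Set
  Adjacent x y = Edge d₁ A B x y ⊎ Edge d₁ A B y x

  Adjacent-sym : ∀ {x y} → Adjacent x y → Adjacent y x
  Adjacent-sym (inj₁ e) = inj₂ e
  Adjacent-sym (inj₂ e) = inj₁ e

  open TruncatedGraph lem Adjacent public

  d₂ : X → X → ℝ
  d₂ = valued tag

  ≢-between : ∀ {a b} → A a → B b → ¬ (a ≡ b)
  ≢-between Aa Bb refl = disjoint _ Aa Bb

  O≼tag-between : ∀ {a b} → A a → B b → O ≼ tag a b
  O≼tag-between Aa Bb = ≢Z⇒O≼ (λ tab≡Z → ≢-between Aa Bb (tag≡Z⇒≡ _ _ tab≡Z))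

  tag-edge : ∀ {a b} → Edge d₁ A B a b → tag a b ≡ O
  tag-edge e@(Aa , Bb , _) = tag-adjacent (≢-between Aa Bb) (inj₁ e)

  sameGraph : NonemptyGraph d₁ A B → SameGraph d₁ d₂ A B
  sameGraph (a₀ , b₀ , e₀) a b = edge₁⇒edge₂ , edge₂⇒edge₁
    where
      edge₁⇒edge₂ : Edge d₁ A B a b → Edge d₂ A B a b
      edge₁⇒edge₂ e@(Aa , Bb , _) = Aa , Bb , λ a′ b′ Aa′ Bb′ →
        val-mono (subst (_≼ tag a′ b′) (sym (tag-edge e)) (O≼tag-between Aa′ Bb′))

      -- d₂ a b ≤ d₂ a₀ b₀ = 1 leaves only the value 1, i.e. an old edge.
      edge₂⇒edge₁ : Edge d₂ A B a b → Edge d₁ A B a b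
      edge₂⇒edge₁ (Aa , Bb , minimal) = oldEdge (tag≼O⇒adjacent (≢-between Aa Bb) tab≼O)
        where
          tab≼O : tag a b ≼ O
          tab≼O = val-cancel-≤ (subst (d₂ a b ≤_) (cong val (tag-edge e₀))
                                      (minimal a₀ b₀ (proj₁ e₀) (proj₁ (proj₂ e₀))))
          oldEdge : Adjacent a b → Edge d₁ A B a b
          oldEdge (inj₁ e) = e
          oldEdge (inj₂ (Ab , _)) = ⊥-elim (disjoint b Ab Bb)

corollary2p3 : (R : RealField) → LEM →
    let open RealField R
        open WithReals R
    in (X : Set) (d₁ : X → X → ℝ) → IsSemimetric d₁ →
       (A B : X → Set) → Disjoint A B →
       Proximinal d₁ A → Proximinal d₁ B → NonemptyGraph d₁ A B →
       ∃ λ (d₂ : X → X → ℝ) → IsMetric d₂ × Proximinal d₂ A × Proximinal d₂ B ×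
         SameGraph d₁ d₂ A B × DistanceSetAtMost3 d₂
corollary2p3 R lem X d₁ _ A B disjoint _ _ graph@(a₀ , b₀ , Aa₀ , Bb₀ , _) =
  d₂ , isMetric tag (tag-sym Adjacent-sym) tag≡Z⇒≡ tag-refl
     , proximinal tag lem A (a₀ , Aa₀) , proximinal tag lem B (b₀ , Bb₀)
     , sameGraph graph , distanceSetAtMost3 tag
  where
    open ThreeValued R
    open EdgesOfTruncatedGraph R lem d₁ A B disjoint
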